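{- Let $\mathcal H=\{(\mathrm{dup},\mathrm{Dup})\}$. Then the halting problem for $\mathcal L(f.\{\mathrm{dup}\})$ with respect to $\mathcal H$ is decidable, i.e. the set of pairs $(x,s)$ with $x\in\mathcal L(f.\{\mathrm{dup}\})$, $s\in\mathcal S_{\mathrm{BS}}$ and $x\downarrow f.\mathcal H(s)$ is decidable.
   Context: Fix a focus $f$ and the method name $\mathrm{dup}$. $\mathcal L(f.\{\mathrm{dup}\})$ is the set of finite nonempty sequences $x=u_1;\dots;u_k$ of primitive instructions, each of one of the forms $f.\mathrm{dup}$, $+f.\mathrm{dup}$, $-f.\mathrm{dup}$; $\#l$ or $\backslash\#l$ with $l\in\mathbb N$; $!t$; $!f$. Functional units. A method operation on a state set $S$ is a total function $M:S\to\{\mathsf T,\mathsf F\}\times S$; a functional unit is a finite set of pairs (method name, method operation) with no method name occurring twice; $\mathrm{IF}(\mathcal H)$ is its set of method names and $m_{\mathcal H}$ the operation paired with $m$. Execution. Executing $x=u_1;\dots;u_k$ on $f.\mathcal H(s)$ (a single service named $f$ behaving according to $\mathcal H$ in state $s$): current position $i$ (initially $1$), current state (initially $s$). If not $1\le i\le k$, execution deadlocks. If $u_i$ is $f.m$, $+f.m$ or $-f.m$ with $m\notin\mathrm{IF}(\mathcal H)$, execution deadlocks. Otherwise, with $(b,s')=m_{\mathcal H}(\text{current state})$, the state becomes $s'$ and execution proceeds at $i+1$ for $f.m$; at $i+1$ if $b=\mathsf T$ and $i+2$ otherwise for $+f.m$; at $i+2$ if $b=\mathsf T$ and $i+1$ otherwise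 for $-f.m$. For $\#l$ execution proceeds at $i+l$ (deadlock if $l=0$); for $\backslash\#l$ at $i-l$ (deadlock if $l=0$ or $i-l<1$). On $!t$ or $!f$ execution terminates. $x\downarrow f.\mathcal H(s)$ ($x$ converges) means execution terminates. Tape states. $\mathcal S_{\mathrm{BS}}=\{v\triangleright w: v,w\in\{0,1,{:}\}^*\}$, with ${:}$ a separator symbol and $\triangleright$ marking the head position; juxtaposition is concatenation. $\mathrm{Dup}$ is the method operation on $\mathcal S_{\mathrm{BS}}$ with $\mathrm{Dup}(v\triangleright w)=\mathrm{Dup}(\triangleright vw)$; $\mathrm{Dup}(\triangleright v)=(\mathsf T,\triangleright v{:}v)$ if $v\in\{0,1\}^*$; $\mathrm{Dup}(\triangleright v{:}w)=(\mathsf T,\triangleright v{:}v{:}w)$ if $v\in\{0,1\}^*$. -}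

module Defs where

open import Data.Nat using (ℕ; zero; suc; _+_; _∸_; _<_; _≤?_)
open import Data.Bool using (Bool; true; false)
open import Data.List using (List; []; _∷_; _++_)
open import Data.List.NonEmpty using (List⁺; toList)
open import Data.Maybe using (Maybe; just; nothing)
open import Data.Product using (_×_; _,_; ∃-syntax)
open import Relation.Binary.PropositionalEquality using (_≡_)
open import Relation.Nullary using (yes; no)

data Sym : Set where
  𝟘 𝟙 sep : Sym

-- v ▷ w is represented by the pair (v , w)
StateBS : Set
StateBS = List Sym × List Sym

MethodOp : Set → Set
MethodOp S = S → Bool × S

splitSep : List Sym → List Sym × Maybe (List Sym)
splitSep [] = [] , nothing
splitSep (sep ∷ w) = [] , just w
splitSep (𝟘 ∷ u) with splitSep u
... | v , r = 𝟘 ∷ v , r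
splitSep (𝟙 ∷ u) with splitSep u
... | v , r = 𝟙 ∷ v , r

-- Dup(▷ v) = (T, ▷ v:v) for v ∈ {0,1}*,  Dup(▷ v:w) = (T, ▷ v:v:w) for v ∈ {0,1}*
dupHead : List Sym → List Sym
dupHead u with splitSep u
... | v , nothing = v ++ (sep ∷ v)
... | v , just w  = v ++ (sep ∷ v ++ (sep ∷ w))

-- Dup(v ▷ w) = Dup(▷ vw)
Dup : MethodOp StateBS
Dup (v , w) = true , ([] , dupHead (v ++ w))

data Instr : Set where
  call   : Instr
  pcall  : Instr
  ncall  : Instr
  fjump  : ℕ → Instr
  bjump  : ℕ → Instr
  haltT  : Instr
  haltF  : Instr

Program : Set
Program = List⁺ Instr

-- Execution on f.H(s) with H = {(dup, Dup)}: since IF(H) = {dup}, every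
-- method call in L(f.{dup}) is answered by the operation M = Dup.

-- 1-based fetch: nothing if the position is not in 1..k
fetch : List Instr → ℕ → Maybe Instr
fetch is zero = nothing
fetch [] (suc i) = nothing
fetch (u ∷ is) (suc zero) = just u
fetch (u ∷ is) (suc (suc i)) = fetch is (suc i)

Config : Set → Set
Config S = ℕ × S

data Result (S : Set) : Set where
  terminated : Result S
  deadlocked : Result S
  continue   : Config S → Result S

step : {S : Set} → MethodOp S → Program → Config S → Result S
step M x (i , s) with fetch (toList x) i
... | nothing = deadlocked
... | just call with M s
...   | b , s' = continue (suc i , s')
step M x (i , s) | just pcall with M s
...   | true  , s' = continue (suc i , s')
...   | false , s' = continue (suc (suc i) , s')
step M x (i , s) | just ncall with M s
...   | true  , s' = continue (suc (suc i) , s')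
...   | false , s' = continue (suc i , s')
step M x (i , s) | just (fjump zero) = deadlocked
step M x (i , s) | just (fjump (suc l)) = continue (i + suc l , s)
step M x (i , s) | just (bjump zero) = deadlocked
step M x (i , s) | just (bjump (suc l)) with suc (suc l) ≤? i   -- i - (l+1) ≥ 1
...   | yes _ = continue (i ∸ suc l , s)
...   | no  _ = deadlocked
step M x (i , s) | just haltT = terminated
step M x (i , s) | just haltF = terminated

run : {S : Set} → MethodOp S → ℕ → Program → Config S → Result S
run M zero x c = continue c
run M (suc n) x c with step M x c
... | continue c' = run M n x c'
... | r = r

Converges : {S : Set} → MethodOp S → Program → S → Set
Converges M x s = ∃[ n ] (run M n x (1 , s) ≡ terminated)

_↓Dup_ : Program → StateBS → Set
x ↓Dup s = Converges Dup x s

-- Dup always replies T, so the instruction pointer evolves independently of the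
-- tape: forgetting the tape turns the execution into a deterministic system on
-- the positions 1..k of the program. A terminating run of more than k + 1 steps
-- visits some position twice before halting, and cutting out that cycle gives a
-- shorter terminating run; hence x ↓ Dup s iff x terminates within k + 1 steps.
module Submission where

open import Defs
open import Data.Bool using (Bool)
open import Data.Fin using (Fin; toℕ)
open import Data.Fin.Properties using (pigeonhole; toℕ<n)
open import Data.List using ([]; _∷_; length)
open import Data.List.NonEmpty using (toList)
open import Data.Maybe using (just; nothing)
open import Data.Nat using (ℕ; zero; suc; _+_; _∸_; _≤_; _<_; _≤?_)
open import Data.Nat.Induction using (<-rec)
open import Data.Nat.Properties
  using (≤-refl; ≤-trans; <-≤-trans; ≤-pred; <⇒≤; ≰⇒>; <-trans; n<1+n; +-comm; m+[n∸m]≡n; +-monoˡ-<)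
open import Data.Product using (Σ; ∃₂; _×_; _,_; proj₁)
open import Data.Unit using (⊤; tt)
open import Relation.Binary.PropositionalEquality
open import Relation.Nullary using (Dec; yes; no; ¬_; contradiction)
open import Relation.Nullary.Decidable using (map′)

private
  variable
    S : Set
    M : MethodOp S
    x : Program

ConstantReply : Bool → MethodOp S → Set
ConstantReply b M = ∀ s → proj₁ (M s) ≡ b

constantOp : Bool → MethodOp ⊤
constantOp b _ = b , tt

terminated? : (r : Result S) → Dec (r ≡ terminated)
terminated? terminated   = yes refl
terminated? deadlocked   = no λ ()
terminated? (continue _) = no λ ()

fetch-just : ∀ is p {u} → fetch is p ≡ just u → Σ (Fin (length is)) λ j → p ≡ suc (toℕ j)
fetch-just _        zero          ()
fetch-just []       (suc p)       ()
fetch-just (_ ∷ _)  (suc zero)    _  = Fin.zero , refl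
fetch-just (_ ∷ is) (suc (suc p)) eq with fetch-just is (suc p) eq
... | j , refl = Fin.suc j , refl

resume : MethodOp S → ℕ → Program → Result S → Result S
resume M n x (continue c) = run M n x c
resume M n x r            = r

run-+ : ∀ m n c → run M (m + n) x c ≡ resume M n x (run M m x c)
run-+ zero n c = refl
run-+ {M = M} {x = x} (suc m) n c with step M x c
... | terminated   = refl
... | deadlocked   = refl
... | continue c′  = run-+ m n c′

data Halted {S : Set} : Result S → Set where
  terminated : Halted terminated
  deadlocked : Halted deadlocked

run-halted-mono : ∀ {m n c r} → Halted r → m ≤ n → run M m x c ≡ r → run M n x c ≡ r
run-halted-mono {M = M} {x = x} {m} {n} {c} {r} h m≤n at-m = begin
  run M n x c                        ≡⟨ cong (λ z → run M z x c) (sym (m+[n∸m]≡n m≤n)) ⟩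
  run M (m + (n ∸ m)) x c            ≡⟨ run-+ m (n ∸ m) c ⟩
  resume M (n ∸ m) x (run M m x c)   ≡⟨ cong (resume M (n ∸ m) x) at-m ⟩
  resume M (n ∸ m) x r               ≡⟨ resume-halted h ⟩
  r                                  ∎
  where
  open ≡-Reasoning
  resume-halted : ∀ {r} → Halted r → resume M (n ∸ m) x r ≡ r
  resume-halted terminated = refl
  resume-halted deadlocked = refl

run-skip-cycle : ∀ a {b n c} → b ≤ n → run M a x c ≡ run M b x c →
                 run M (a + (n ∸ b)) x c ≡ run M n x c
run-skip-cycle {M = M} {x = x} a {b} {n} {c} b≤n cycle = begin
  run M (a + (n ∸ b)) x c            ≡⟨ run-+ a (n ∸ b) c ⟩
  resume M (n ∸ b) x (run M a x c)   ≡⟨ cong (resume M (n ∸ b) x) cycle ⟩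
  resume M (n ∸ b) x (run M b x c)   ≡⟨ sym (run-+ b (n ∸ b) c) ⟩
  run M (b + (n ∸ b)) x c            ≡⟨ cong (λ z → run M z x c) (m+[n∸m]≡n b≤n) ⟩
  run M n x c                        ∎
  where open ≡-Reasoning

run-outside : ∀ t {c p s} → run M t x c ≡ continue (p , s) → fetch (toList x) p ≡ nothing →
              run M (suc t) x c ≡ deadlocked
run-outside {M = M} {x = x} t {c} {p} {s} at-p outside = begin
  run M (suc t) x c                ≡⟨ cong (λ z → run M z x c) (+-comm 1 t) ⟩
  run M (t + 1) x c                ≡⟨ run-+ t 1 c ⟩
  resume M 1 x (run M t x c)       ≡⟨ cong (resume M 1 x) at-p ⟩
  run M 1 x (p , s)                ≡⟨ run-one ⟩
  deadlocked                       ∎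
  where
  open ≡-Reasoning
  run-one : run M 1 x (p , s) ≡ deadlocked
  run-one rewrite outside = refl

position-before-termination :
  ∀ {t n c p s} → t < n → run M n x c ≡ terminated → run M t x c ≡ continue (p , s) →
  Σ (Fin (length (toList x))) λ j → p ≡ suc (toℕ j)
position-before-termination {M = M} {x = x} {t} {c = c} {p} t<n done at-p
  with fetch (toList x) p in eq
... | just _  = fetch-just (toList x) p eq
... | nothing = contradiction (trans (sym (run-halted-mono deadlocked t<n dead)) done) λ ()
  where
  dead : run M (suc t) x c ≡ deadlocked
  dead = run-outside t at-p eq

forget : Result S → Result ⊤
forget terminated         = terminated
forget deadlocked         = deadlocked
forget (continue (i , _)) = continue (i , tt)

forget-terminated : ∀ {r : Result S} → forget r ≡ terminated → r ≡ terminated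
forget-terminated {r = terminated} _ = refl

module _ {b : Bool} (reply : ConstantReply b M) where

  step-forget : ∀ i s → forget (step M x (i , s)) ≡ step (constantOp b) x (i , tt)
  step-forget {x = x} i s with fetch (toList x) i
  ... | nothing              = refl
  ... | just (fjump zero)    = refl
  ... | just (fjump (suc l)) = refl
  ... | just (bjump zero)    = refl
  ... | just (bjump (suc l)) with suc (suc l) ≤? i
  ...   | yes _ = refl
  ...   | no  _ = refl
  step-forget i s | just haltT = refl
  step-forget i s | just haltF = refl
  step-forget i s | just call  with M s | reply s
  ...   | _ , _ | refl = refl
  step-forget i s | just pcall with M s | reply s
  ...   | Bool.true  , _ | refl = refl
  ...   | Bool.false , _ | refl = refl
  step-forget i s | just ncall with M s | reply s
  ...   | Bool.true  , _ | refl = refl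
  ...   | Bool.false , _ | refl = refl

  run-forget : ∀ n i s → forget (run M n x (i , s)) ≡ run (constantOp b) n x (i , tt)
  run-forget {x = x} zero i s = refl
  run-forget {x = x} (suc n) i s
    with step M x (i , s) | step (constantOp b) x (i , tt) | step-forget {x = x} i s
  ... | terminated         | _ | refl = refl
  ... | deadlocked         | _ | refl = refl
  ... | continue (j , s′)  | _ | refl = run-forget n j s′

  converges-forget : ∀ s → Converges M x s → Converges (constantOp b) x tt
  converges-forget {x = x} s (n , done) = n , trans (sym (run-forget {x = x} n 1 s)) (cong forget done)

  converges-unforget : ∀ s → Converges (constantOp b) x tt → Converges M x s
  converges-unforget {x = x} s (n , done) = n , forget-terminated (trans (run-forget {x = x} n 1 s) done)

module _ (M : MethodOp ⊤) (x : Program) where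

  private
    k : ℕ
    k = length (toList x)

    orbit : ℕ → Result ⊤
    orbit t = run M t x (1 , tt)

    below : ∀ {n} → suc k ≤ n → (t : Fin (suc k)) → toℕ t < n
    below k+1≤n t = <-≤-trans (toℕ<n t) k+1≤n

  position-while-running : ¬ orbit (suc k) ≡ terminated → ∀ {n} → orbit n ≡ terminated → suc k ≤ n →
                           (t : Fin (suc k)) → Σ (Fin k) λ j → orbit (toℕ t) ≡ continue (suc (toℕ j) , tt)
  position-while-running late done k+1≤n t with orbit (toℕ t) in at-t
  ... | terminated = contradiction (run-halted-mono terminated (<⇒≤ (toℕ<n t)) at-t) late
  ... | deadlocked =
    contradiction (trans (sym (run-halted-mono deadlocked (<⇒≤ (below k+1≤n t)) at-t)) done) λ ()
  ... | continue (p , tt) with position-before-termination (below k+1≤n t) done at-t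
  ...   | j , refl = j , refl

  orbit-repeats : ¬ orbit (suc k) ≡ terminated → ∀ {n} → orbit n ≡ terminated → suc k ≤ n →
                  ∃₂ λ a b → a < b × b ≤ k × orbit a ≡ orbit b
  orbit-repeats late done k+1≤n
    with pigeonhole ≤-refl (λ t → proj₁ (position-while-running late done k+1≤n t))
  ... | i , j , i<j , same
    with position-while-running late done k+1≤n i | position-while-running late done k+1≤n j | same
  ...   | p , at-i | .p , at-j | refl = toℕ i , toℕ j , i<j , ≤-pred (toℕ<n j) , trans at-i (sym at-j)

  no-late-termination : ¬ orbit (suc k) ≡ terminated → ∀ n → ¬ orbit n ≡ terminated
  no-late-termination late = <-rec (λ n → ¬ orbit n ≡ terminated) shorten
    where
    shorten : ∀ n → (∀ {m} → m < n → ¬ orbit m ≡ terminated) → ¬ orbit n ≡ terminated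
    shorten n shorter done with n ≤? suc k
    ... | yes n≤k+1 = late (run-halted-mono terminated n≤k+1 done)
    ... | no  n≰k+1 with orbit-repeats late done (<⇒≤ (≰⇒> n≰k+1))
    ...   | a , b , a<b , b≤k , cycle = shorter shortened (trans (run-skip-cycle a b≤n cycle) done)
      where
      b≤n : b ≤ n
      b≤n = ≤-trans b≤k (<⇒≤ (<-trans (n<1+n k) (≰⇒> n≰k+1)))
      shortened : a + (n ∸ b) < n
      shortened = subst (a + (n ∸ b) <_) (m+[n∸m]≡n b≤n) (+-monoˡ-< (n ∸ b) a<b)

  converges-stateless? : Dec (Converges M x tt)
  converges-stateless? with terminated? (orbit (suc k))
  ... | yes done = yes (suc k , done)
  ... | no  late = no λ (n , done) → no-late-termination late n done

converges? : ∀ {b} → ConstantReply b M → (x : Program) (s : S) → Dec (Converges M x s)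
converges? {b = b} reply x s =
  map′ (converges-unforget reply s) (converges-forget reply s) (converges-stateless? (constantOp b) x)

theorem5 : (x : Program) (s : StateBS) → Dec (x ↓Dup s)
theorem5 = converges? λ _ → refl
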